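{- Let $p,q$ be primes with $2<p<q$. If $\kappa+\lambda\le p-\lambda$, then $g\le g_1$.
   Context: Let $p,q$ be primes with $2<p<q$, and put $p'=(p-1)/2$, $q'=(q-1)/2$. Set $d_0=pq$, $d_1=p'q$, $d_2=pq'$, $d_3=(pq-1)/2$, and for integers $x,y,z,w$ put $f(x,y,z,w)=xd_0+yd_1+zd_2+wd_3$. A positive integer is representable if it equals $f(x,y,z,w)$ for some nonnegative integers $x,y,z,w$; the Frobenius number $g$ is the largest positive integer that is not representable. Define $\kappa,\lambda$ by $q=\kappa p+\lambda$ with $1\le\lambda\le p-1$, and put $g_0=f(p'-1,p-1,\kappa,-1)$ and $g_1=g_0-\lambda d_3$. -}

module Defs where

open import Data.Nat as ℕ using (ℕ)
import Data.Nat.DivMod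
open import Data.Integer using (ℤ; +_; _+_; _*_; _-_; _≤_; _<_)
open import Data.Product using (Σ; ∃; _×_; _,_)
open import Relation.Binary.PropositionalEquality using (_≡_)

module Params (p q : ℕ) .{{_ : ℕ.NonZero p}} where
  p′ q′ : ℕ
  p′ = (p ℕ.∸ 1 ) Data.Nat.DivMod./ 2
  q′ = (q ℕ.∸ 1 ) Data.Nat.DivMod./ 2

  d₀ d₁ d₂ d₃ : ℕ
  d₀ = p ℕ.* q
  d₁ = p′ ℕ.* q
  d₂ = p ℕ.* q′
  d₃ = (p ℕ.* q ℕ.∸ 1 ) Data.Nat.DivMod./ 2

  f : ℤ → ℤ → ℤ → ℤ → ℤ
  f x y z w = x * + d₀ + y * + d₁ + z * + d₂ + w * + d₃

  Representable : ℕ → Set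
  Representable n = Σ ℕ λ x → Σ ℕ λ y → Σ ℕ λ z → Σ ℕ λ w →
    + n ≡ f (+ x) (+ y) (+ z) (+ w)

  IsFrobeniusNumber : ℕ → Set
  IsFrobeniusNumber g =
    (0 ℕ.< g) × (Representable g → Data.Empty.⊥) × (∀ n → g ℕ.< n → Representable n)
    where import Data.Empty

  -- q = κ p + λ  (λ = q mod p; 1 ≤ λ ≤ p-1 when p, q are distinct primes)
  κ λ′ : ℕ
  κ  = q Data.Nat.DivMod./ p
  λ′ = q Data.Nat.DivMod.% p

  g₀ g₁ : ℤ
  g₀ = f (+ (p′ ℕ.∸ 1)) (+ (p ℕ.∸ 1)) (+ κ) (Data.Integer.- + 1)
    where import Data.Integer
  g₁ = g₀ - + λ′ * + d₃

{-# OPTIONS --safe #-}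
module Submission where

-- With p = 1 + 2p′ and q = 1 + 2q′ we have 2d₁ = pq − q, 2d₂ = pq − p and 2d₃ = pq − 1, so
-- 2 f(x,y,z,w) = (2x + y + z + w)·pq − (yq + zp + w). Given n, let T = ⌈2n/pq⌉ and
-- D = T·pq − 2n < pq. Expanding D in the mixed radix (q, p, 1), borrowing one q when the unit
-- digit allows it, gives D = yq + zp + w with y + z + w ≤ T + 1 as soon as n > g₁; this is where
-- κ + 2λ ≤ p enters. Since p, q and pq are odd, y + z + w ≡ T (mod 2), hence y + z + w ≤ T and
-- x = (T − y − z − w)/2 represents n.

open import Defs
open import Data.Empty using (⊥-elim)
open import Data.Integer as ℤ using (+_)
open import Data.List using (_∷_; [])
open import Data.Nat
open import Data.Nat.Divisibility using (m%n≡0⇒n∣m)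
open import Data.Nat.DivMod
open import Data.Nat.Primality using (Prime; composite)
open import Data.Nat.Properties
open import Data.Nat.Tactic.RingSolver using (solve; solve-∀)
open import Data.Product using (∃-syntax; _×_; _,_)
open import Data.Sum using (_⊎_; inj₁; inj₂)
open import Relation.Binary.PropositionalEquality
open import Relation.Nullary using (yes; no)
import Data.Integer.Properties as ℤₚ
import Data.Integer.Tactic.RingSolver as ℤ-Solver

prime>2⇒odd : ∀ {p} → Prime p → 2 < p → ∃[ h ] p ≡ 1 + 2 * h
prime>2⇒odd {p} p-prime 2<p with p % 2 in p%2≡ | m%n<n p 2
... | 0           | _ = ⊥-elim (Prime.notComposite p-prime (composite 2<p (m%n≡0⇒n∣m p 2 p%2≡)))
... | 1           | _ = p / 2 , trans (m≡m%n+[m/n]*n p 2) (cong₂ _+_ p%2≡ (*-comm (p / 2) 2))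
... | suc (suc _) | s≤s (s≤s ())

odd⇒≡1+2*[n∸1]/2 : ∀ {n} → ∃[ h ] n ≡ 1 + 2 * h → n ≡ 1 + 2 * ((n ∸ 1) / 2)
odd⇒≡1+2*[n∸1]/2 (h , refl) =
  cong (λ t → 1 + 2 * t) (sym (trans (cong (_/ 2) (*-comm 2 h)) (m*n/n≡m h 2)))

1+2h>2⇒0<h : ∀ {n h} → n ≡ 1 + 2 * h → 2 < n → 0 < h
1+2h>2⇒0<h {h = zero}  refl (s≤s ())
1+2h>2⇒0<h {h = suc _} _    _ = z<s

odd*odd : ∀ a b → (1 + 2 * a) * (1 + 2 * b) ≡ 1 + 2 * (a + b + 2 * (a * b))
odd*odd = solve-∀

even-gap : ∀ {T C α β} → C ≤ suc T → T + 2 * α ≡ C + 2 * β → ∃[ x ] T ≡ C + 2 * x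
even-gap {T} {C} {α} {β} C≤1+T eq with m≤n⇒m<n∨m≡n C≤1+T
... | inj₂ refl = ⊥-elim (even≢odd α β (+-cancelˡ-≡ T _ _ (trans eq (sym (+-suc T (2 * β))))))
... | inj₁ (s≤s C≤T) with r , refl ← m≤n⇒∃[o]m+o≡n C≤T = β ∸ α , cong (_+_ C) r≡2[β∸α]
  where
  open ≡-Reasoning
  r+2α≡2β : r + 2 * α ≡ 2 * β
  r+2α≡2β = +-cancelˡ-≡ C _ _ (trans (sym (+-assoc C r (2 * α))) eq)
  r≡2[β∸α] : r ≡ 2 * (β ∸ α)
  r≡2[β∸α] = begin
    r                  ≡⟨ m+n∸n≡m r (2 * α) ⟨
    r + 2 * α ∸ 2 * α  ≡⟨ cong (_∸ 2 * α) r+2α≡2β ⟩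
    2 * β ∸ 2 * α      ≡⟨ *-distribˡ-∸ 2 β α ⟨
    2 * (β ∸ α)        ∎

divide-up : ∀ N m .{{_ : NonZero m}} → ∃[ T ] ∃[ D ] D < m × T * m ≡ N + D
divide-up N m with N % m | m≡m%n+[m/n]*n N m | m%n<n N m
... | zero  | N≡ | _   = N / m , 0 , >-nonZero⁻¹ m , trans (sym N≡) (sym (+-identityʳ N))
... | suc r | N≡ | 1+r<m = suc (N / m) , m ∸ suc r , ∸-monoʳ-< z<s (<⇒≤ 1+r<m) , (begin
    m + N / m * m                        ≡⟨ cong (_+ N / m * m) (m∸n+n≡m (<⇒≤ 1+r<m)) ⟨
    m ∸ suc r + suc r + N / m * m        ≡⟨ +-assoc (m ∸ suc r) (suc r) _ ⟩
    m ∸ suc r + (suc r + N / m * m)      ≡⟨ cong (_+_ (m ∸ suc r)) N≡ ⟨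
    m ∸ suc r + N                        ≡⟨ +-comm (m ∸ suc r) N ⟩
    N + (m ∸ suc r)                      ∎)
  where open ≡-Reasoning

+-mono-≤⇒<⊎≡ : ∀ {m n o r} → m ≤ o → n ≤ r → m + n < o + r ⊎ (m ≡ o × n ≡ r)
+-mono-≤⇒<⊎≡ m≤o n≤r with m≤n⇒m<n∨m≡n m≤o | m≤n⇒m<n∨m≡n n≤r
... | inj₁ m<o | _        = inj₁ (+-mono-<-≤ m<o n≤r)
... | inj₂ m≡o | inj₁ n<r = inj₁ (+-mono-≤-< (≤-reflexive m≡o) n<r)
... | inj₂ m≡o | inj₂ n≡r = inj₂ (m≡o , n≡r)

module DigitExpansion {p q K L : ℕ}
         (q≡Kp+L : q ≡ K * p + L) (0<K : 0 < K) (K+2L≤p : K + 2 * L ≤ p) where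

  2L<p : 2 * L < p
  2L<p = ≤-trans (+-monoˡ-≤ (2 * L) 0<K) K+2L≤p

  instance
    p≢0 : NonZero p
    p≢0 = >-nonZero (≤-<-trans z≤n 2L<p)
    q≢0 : NonZero q
    q≢0 = >-nonZero (begin-strict
      0          <⟨ >-nonZero⁻¹ p ⟩
      p          ≤⟨ m≤n*m p K {{>-nonZero 0<K}} ⟩
      K * p      ≤⟨ m≤m+n (K * p) L ⟩
      K * p + L  ≡⟨ q≡Kp+L ⟨
      q          ∎)
      where open ≤-Reasoning

  -- When n > g₁ we have (2p + K)·pq + 2L + 3 ≤ 2n + (L + 6)·pq, so for T·pq = 2n + D this
  -- bound is exactly what makes the length C at most T + 1.
  WeightBound : ℕ → ℕ → Set
  WeightBound D C = (C + L + 4) * (p * q) ≤ (2 * p + K) * (p * q) + (D + 2 * L + 1)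

  BoundedExpansion : ℕ → Set
  BoundedExpansion D = ∃[ y ] ∃[ z ] ∃[ w ] y * q + z * p + w ≡ D × WeightBound D (y + z + w)

  slack : ∀ {D C} → C + L + 4 ≤ 2 * p + K → WeightBound D C
  slack h = ≤-trans (*-monoˡ-≤ (p * q) h) (m≤m+n _ _)

  tight : ∀ {D C} → C + L + 3 ≤ 2 * p + K → p * q ≤ D + 2 * L + 1 → WeightBound D C
  tight {D} {C} h pq≤ = begin
    (C + L + 4) * (p * q)                    ≡⟨ solve (C ∷ L ∷ p ∷ q ∷ []) ⟩
    (C + L + 3) * (p * q) + p * q            ≤⟨ +-mono-≤ (*-monoˡ-≤ (p * q) h) pq≤ ⟩
    (2 * p + K) * (p * q) + (D + 2 * L + 1)  ∎
    where open ≤-Reasoning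

  last-row : ∀ {a r} → suc a ≡ p → q ≤ r + 2 * L + 1 → p * q ≤ a * q + r + 2 * L + 1
  last-row {a} {r} 1+a≡p q≤ = begin
    p * q                  ≡⟨ cong (_* q) 1+a≡p ⟨
    q + a * q              ≤⟨ +-monoˡ-≤ (a * q) q≤ ⟩
    r + 2 * L + 1 + a * q  ≡⟨ solve (r ∷ L ∷ a ∷ q ∷ []) ⟩
    a * q + r + 2 * L + 1  ∎
    where open ≤-Reasoning

  p+p+K≡2p+K : p + p + K ≡ 2 * p + K
  p+p+K≡2p+K = solve (p ∷ K ∷ [])

  -- Only an expansion whose leading digit a is maximal may need the weaker alternative of tight.
  row-bound : ∀ {a r C} → a < p → C + L + 3 ≤ suc a + p + K →
              (suc a ≡ p → C + L + 4 ≤ 2 * p + K ⊎ q ≤ r + 2 * L + 1) →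
              WeightBound (a * q + r) C
  row-bound {a} {r} {C} a<p length≤ last with m≤n⇒m<n∨m≡n a<p
  ... | inj₁ 1+a<p = slack {a * q + r} (begin
    C + L + 4            ≡⟨ +-suc (C + L) 3 ⟩
    suc (C + L + 3)      ≤⟨ s≤s length≤ ⟩
    suc (suc a + p + K)  ≤⟨ +-monoˡ-≤ K (+-monoˡ-≤ p 1+a<p) ⟩
    p + p + K            ≡⟨ p+p+K≡2p+K ⟩
    2 * p + K            ∎)
    where open ≤-Reasoning
  ... | inj₂ 1+a≡p with last 1+a≡p
  ...   | inj₁ short = slack {a * q + r} short
  ...   | inj₂ q≤    = tight {a * q + r} (begin
    C + L + 3      ≤⟨ length≤ ⟩
    suc a + p + K  ≡⟨ cong (λ t → t + p + K) 1+a≡p ⟩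
    p + p + K      ≡⟨ p+p+K≡2p+K ⟩
    2 * p + K      ∎) (last-row {a} {r} 1+a≡p q≤)
    where open ≤-Reasoning

  expand-full-row : ∀ {a e} → a < p → e < L → BoundedExpansion (a * q + (K * p + e))
  expand-full-row {a} {e} a<p e<L =
    a , K , e , +-assoc (a * q) (K * p) e , row-bound a<p length≤ (λ _ → inj₂ q≤)
    where
    open ≤-Reasoning
    length≤ : a + K + e + L + 3 ≤ suc a + p + K
    length≤ = begin
      a + K + e + L + 3            ≡⟨ solve (a ∷ K ∷ e ∷ L ∷ []) ⟩
      suc a + K + (suc e + L + 1)  ≤⟨ +-monoʳ-≤ (suc a + K) (+-monoˡ-≤ 1 (+-monoˡ-≤ L e<L)) ⟩
      suc a + K + (L + L + 1)      ≡⟨ solve (a ∷ K ∷ L ∷ []) ⟩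
      suc a + K + suc (2 * L)      ≤⟨ +-monoʳ-≤ (suc a + K) 2L<p ⟩
      suc a + K + p                ≡⟨ solve (a ∷ K ∷ p ∷ []) ⟩
      suc a + p + K                ∎
    q≤ : q ≤ K * p + e + 2 * L + 1
    q≤ = begin
      q                          ≡⟨ q≡Kp+L ⟩
      K * p + L                  ≤⟨ m≤m+n (K * p + L) (e + L + 1) ⟩
      K * p + L + (e + L + 1)    ≡⟨ solve (K ∷ p ∷ L ∷ e ∷ []) ⟩
      K * p + e + 2 * L + 1      ∎

  expand-within-row : ∀ {a c e} → a < p → c < K → e + L < p →
                      BoundedExpansion (a * q + (c * p + e))
  expand-within-row {a} {c} {e} a<p c<K e+L<p =
    a , c , e , +-assoc (a * q) (c * p) e , row-bound a<p length≤ last-digit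
    where
    open ≤-Reasoning
    length≤ : a + c + e + L + 3 ≤ suc a + p + K
    length≤ = begin
      a + c + e + L + 3            ≡⟨ solve (a ∷ c ∷ e ∷ L ∷ []) ⟩
      suc a + suc (e + L) + suc c  ≤⟨ +-mono-≤ (+-monoʳ-≤ (suc a) e+L<p) c<K ⟩
      suc a + p + K                ∎
    last-digit : suc a ≡ p → a + c + e + L + 4 ≤ 2 * p + K ⊎ q ≤ c * p + e + 2 * L + 1
    last-digit 1+a≡p with +-mono-≤⇒<⊎≡ c<K e+L<p
    ... | inj₁ digits<K+p = inj₁ (begin
      a + c + e + L + 4                    ≡⟨ solve (a ∷ c ∷ e ∷ L ∷ []) ⟩
      suc a + suc (suc c + suc (e + L))    ≤⟨ +-mono-≤ (≤-reflexive 1+a≡p) digits<K+p ⟩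
      p + (K + p)                          ≡⟨ solve (p ∷ K ∷ []) ⟩
      2 * p + K                            ∎)
    ... | inj₂ (1+c≡K , 1+e+L≡p) = inj₂ (≤-reflexive (begin-equality
      q                        ≡⟨ q≡Kp+L ⟩
      K * p + L                ≡⟨ cong (λ k → k * p + L) 1+c≡K ⟨
      p + c * p + L            ≡⟨ cong (λ t → t + c * p + L) 1+e+L≡p ⟨
      suc (e + L) + c * p + L  ≡⟨ solve (e ∷ L ∷ c ∷ p ∷ []) ⟩
      c * p + e + 2 * L + 1    ∎))

  expand-first-row : ∀ {c e w} → c < K → e < p → p + w ≡ e + L →
                     BoundedExpansion (0 * q + (c * p + e))
  expand-first-row {c} {e} {w} c<K e<p p+w≡e+L = 0 , c , e , refl , slack {c * p + e} (begin
    c + e + L + 4              ≡⟨ solve (c ∷ e ∷ L ∷ []) ⟩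
    suc c + (suc e + (L + 2))  ≤⟨ +-mono-≤ c<K (+-mono-≤ e<p L+2≤p) ⟩
    K + (p + p)                ≡⟨ solve (K ∷ p ∷ []) ⟩
    2 * p + K                  ∎)
    where
    open ≤-Reasoning
    0<L : 0 < L
    0<L = +-cancelˡ-< e 0 L (begin-strict
      e + 0      ≡⟨ +-identityʳ e ⟩
      e          <⟨ e<p ⟩
      p          ≤⟨ m≤m+n p w ⟩
      p + w      ≡⟨ p+w≡e+L ⟩
      e + L      ∎)
    L+2≤p : L + 2 ≤ p
    L+2≤p = begin
      L + 2        ≡⟨ +-comm L 2 ⟩
      suc (1 + L)  ≤⟨ s≤s (+-monoˡ-≤ L 0<L) ⟩
      suc (L + L)  ≡⟨ cong suc (solve (L ∷ [])) ⟩
      suc (2 * L)  ≤⟨ 2L<p ⟩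
      p            ∎

  -- One q is traded for K + 1 copies of p: q + c p + e = (c + K + 1) p + (e + L − p).
  expand-borrowing : ∀ {a c e w} → suc a < p → c < K → e < p → p + w ≡ e + L →
                     BoundedExpansion (suc a * q + (c * p + e))
  expand-borrowing {a} {c} {e} {w} 1+a<p c<K e<p p+w≡e+L =
    a , c + K + 1 , w , digits , row-bound 1+a<p length≤ last-digit
    where
    open ≤-Reasoning
    digits : a * q + (c + K + 1) * p + w ≡ suc a * q + (c * p + e)
    digits = begin-equality
      a * q + (c + K + 1) * p + w    ≡⟨ solve (a ∷ q ∷ c ∷ K ∷ p ∷ w ∷ []) ⟩
      a * q + c * p + K * p + (p + w) ≡⟨ cong (_+_ (a * q + c * p + K * p)) p+w≡e+L ⟩
      a * q + c * p + K * p + (e + L) ≡⟨ solve (a ∷ q ∷ c ∷ p ∷ K ∷ e ∷ L ∷ []) ⟩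
      (K * p + L) + a * q + (c * p + e) ≡⟨ cong (λ t → t + a * q + (c * p + e)) q≡Kp+L ⟨
      suc a * q + (c * p + e)        ∎
    length+p : a + (c + K + 1) + w + L + 3 + p ≡ suc (suc a) + (suc c + (suc e + (K + 2 * L)))
    length+p = begin-equality
      a + (c + K + 1) + w + L + 3 + p  ≡⟨ solve (a ∷ c ∷ K ∷ w ∷ L ∷ p ∷ []) ⟩
      a + c + K + L + 4 + (p + w)      ≡⟨ cong (_+_ (a + c + K + L + 4)) p+w≡e+L ⟩
      a + c + K + L + 4 + (e + L)      ≡⟨ solve (a ∷ c ∷ K ∷ L ∷ e ∷ []) ⟩
      suc (suc a) + (suc c + (suc e + (K + 2 * L))) ∎
    length≤ : a + (c + K + 1) + w + L + 3 ≤ suc (suc a) + p + K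
    length≤ = +-cancelʳ-≤ p _ _ (begin
      a + (c + K + 1) + w + L + 3 + p                 ≡⟨ length+p ⟩
      suc (suc a) + (suc c + (suc e + (K + 2 * L)))
        ≤⟨ +-monoʳ-≤ (suc (suc a)) (+-mono-≤ c<K (+-mono-≤ e<p K+2L≤p)) ⟩
      suc (suc a) + (K + (p + p))                     ≡⟨ solve (a ∷ K ∷ p ∷ []) ⟩
      suc (suc a) + p + K + p                         ∎)
    last-digit : suc (suc a) ≡ p →
                 a + (c + K + 1) + w + L + 4 ≤ 2 * p + K ⊎ q ≤ c * p + e + 2 * L + 1
    last-digit 2+a≡p with m≤n⇒m<n∨m≡n c<K
    ... | inj₁ 2+c≤K = inj₁ (+-cancelʳ-≤ p _ _ (begin
      a + (c + K + 1) + w + L + 4 + p                      ≡⟨ solve (a ∷ c ∷ K ∷ w ∷ L ∷ p ∷ []) ⟩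
      suc (a + (c + K + 1) + w + L + 3 + p)                ≡⟨ cong suc length+p ⟩
      suc (suc (suc a) + (suc c + (suc e + (K + 2 * L))))  ≡⟨ solve (a ∷ c ∷ e ∷ K ∷ L ∷ []) ⟩
      suc (suc a) + (suc (suc c) + (suc e + (K + 2 * L)))
        ≤⟨ +-mono-≤ (≤-reflexive 2+a≡p) (+-mono-≤ 2+c≤K (+-mono-≤ e<p K+2L≤p)) ⟩
      p + (K + (p + p))                                    ≡⟨ solve (p ∷ K ∷ []) ⟩
      2 * p + K + p                                        ∎))
    ... | inj₂ 1+c≡K = inj₂ (begin
      q                      ≡⟨ q≡Kp+L ⟩
      K * p + L              ≡⟨ cong (λ k → k * p + L) 1+c≡K ⟨
      p + c * p + L          ≤⟨ +-monoˡ-≤ L (+-monoˡ-≤ (c * p) p≤e+L) ⟩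
      e + L + c * p + L      ≤⟨ n≤1+n _ ⟩
      suc (e + L + c * p + L) ≡⟨ solve (e ∷ L ∷ c ∷ p ∷ []) ⟩
      c * p + e + 2 * L + 1  ∎)
      where
      p≤e+L : p ≤ e + L
      p≤e+L = subst (p ≤_) p+w≡e+L (m≤m+n p w)

  expand-below-full-row : ∀ {a c e} → a < p → c < K → e < p → BoundedExpansion (a * q + (c * p + e))
  expand-below-full-row {a} {c} {e} a<p c<K e<p with e + L <? p
  ... | yes e+L<p = expand-within-row a<p c<K e+L<p
  ... | no  e+L≮p with a | m≤n⇒∃[o]m+o≡n (≮⇒≥ e+L≮p)
  ...   | zero  | _ , p+w≡e+L = expand-first-row c<K e<p p+w≡e+L
  ...   | suc _ | _ , p+w≡e+L = expand-borrowing a<p c<K e<p p+w≡e+L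

  expand-row : ∀ {a r} → a < p → r < q → BoundedExpansion (a * q + r)
  expand-row {a} {r} a<p r<q with K * p ≤? r
  ... | yes Kp≤r with e , refl ← m≤n⇒∃[o]m+o≡n Kp≤r =
    expand-full-row a<p (+-cancelˡ-< (K * p) e L (subst (K * p + e <_) q≡Kp+L r<q))
  ... | no  Kp≰r = subst (λ r → BoundedExpansion (a * q + r)) (sym r≡cp+e)
    (expand-below-full-row a<p (m<n*o⇒m/o<n (≰⇒> Kp≰r)) (m%n<n r p))
    where
    r≡cp+e : r ≡ r / p * p + r % p
    r≡cp+e = trans (m≡m%n+[m/n]*n r p) (+-comm (r % p) _)

  bounded-expansion : ∀ {D} → D < p * q → BoundedExpansion D
  bounded-expansion {D} D<pq =
    subst BoundedExpansion (sym D≡aq+r) (expand-row (m<n*o⇒m/o<n D<pq) (m%n<n D q))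
    where
    D≡aq+r : D ≡ D / q * q + D % q
    D≡aq+r = trans (m≡m%n+[m/n]*n D q) (+-comm (D % q) _)

length≤suc-quotient : ∀ {C T L m n D E} → (C + L + 4) * m ≤ E + (D + 2 * L + 1) →
                      E + 2 * L + 3 ≤ 2 * n + (L + 6) * m → T * m ≡ 2 * n + D → C ≤ suc T
length≤suc-quotient {C} {T} {L} {m} {n} {D} {E} weight lower T*m≡ =
  +-cancelʳ-≤ (L + 5) C (suc T) (begin
    C + (L + 5)      ≡⟨ solve (C ∷ L ∷ []) ⟩
    suc (C + L + 4)  ≤⟨ *-cancelʳ-< m (C + L + 4) (T + L + 6) weights< ⟩
    T + L + 6        ≡⟨ solve (T ∷ L ∷ []) ⟩
    suc T + (L + 5)  ∎)
  where
  open ≤-Reasoning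
  weights< : (C + L + 4) * m < (T + L + 6) * m
  weights< = begin-strict
    (C + L + 4) * m            ≤⟨ weight ⟩
    E + (D + 2 * L + 1)        <⟨ m<n+m _ {2} z<s ⟩
    2 + (E + (D + 2 * L + 1))  ≡⟨ solve (E ∷ D ∷ L ∷ []) ⟩
    E + 2 * L + 3 + D          ≤⟨ +-monoˡ-≤ D lower ⟩
    2 * n + (L + 6) * m + D    ≡⟨ solve (n ∷ L ∷ m ∷ D ∷ []) ⟩
    (2 * n + D) + (L + 6) * m  ≡⟨ cong (_+ (L + 6) * m) T*m≡ ⟨
    T * m + (L + 6) * m        ≡⟨ solve (T ∷ L ∷ m ∷ []) ⟩
    (T + L + 6) * m            ∎

twice-g₀+d₃+Kp : ∀ {p q p′ q′} K → p ≡ 1 + 2 * p′ → q ≡ 1 + 2 * q′ → 0 < p′ →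
           2 * ((p′ ∸ 1) * (p * q) + (p ∸ 1) * (p′ * q) + K * (p * q′)) + 5 * (p * q) + K * p
             ≡ (2 * p + K) * (p * q) + q
twice-g₀+d₃+Kp {p′ = suc k} {q′} K refl refl _ = identity k q′ K
  where
  identity : ∀ k q′ K →
    2 * (k * ((1 + 2 * suc k) * (1 + 2 * q′)) + (2 * suc k) * (suc k * (1 + 2 * q′))
         + K * ((1 + 2 * suc k) * q′)) + 5 * ((1 + 2 * suc k) * (1 + 2 * q′)) + K * (1 + 2 * suc k)
      ≡ (2 * (1 + 2 * suc k) + K) * ((1 + 2 * suc k) * (1 + 2 * q′)) + (1 + 2 * q′)
  identity = solve-∀

module _ {p q p′ q′ d₃ K L : ℕ}
         (p≡ : p ≡ 1 + 2 * p′) (q≡ : q ≡ 1 + 2 * q′) (pq≡ : p * q ≡ 1 + 2 * d₃)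
         (q≡Kp+L : q ≡ K * p + L) (0<p′ : 0 < p′) (0<K : 0 < K) (K+2L≤p : K + 2 * L ≤ p) where

  open DigitExpansion q≡Kp+L 0<K K+2L≤p

  instance
    pq≢0 : NonZero (p * q)
    pq≢0 = subst NonZero (sym pq≡) _

  -- g₁ < n, with both sides moved so that no subtraction occurs: the left side is g₀ + d₃.
  AboveG₁ : ℕ → Set
  AboveG₁ n = (p′ ∸ 1) * (p * q) + (p ∸ 1) * (p′ * q) + K * (p * q′) < n + (1 + L) * d₃

  twice-g₀+d₃ : 2 * ((p′ ∸ 1) * (p * q) + (p ∸ 1) * (p′ * q) + K * (p * q′)) + 5 * (p * q)
                  ≡ (2 * p + K) * (p * q) + L
  twice-g₀+d₃ = +-cancelʳ-≡ (K * p) _ _ (begin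
    2 * ((p′ ∸ 1) * (p * q) + (p ∸ 1) * (p′ * q) + K * (p * q′)) + 5 * (p * q) + K * p
                                         ≡⟨ twice-g₀+d₃+Kp K p≡ q≡ 0<p′ ⟩
    (2 * p + K) * (p * q) + q            ≡⟨ cong (_+_ ((2 * p + K) * (p * q))) q≡Kp+L ⟩
    (2 * p + K) * (p * q) + (K * p + L)  ≡⟨ solve (p ∷ K ∷ q ∷ L ∷ []) ⟩
    (2 * p + K) * (p * q) + L + K * p    ∎)
    where open ≡-Reasoning

  above-g₁⇒lower-bound : ∀ n → AboveG₁ n →
                         (2 * p + K) * (p * q) + 2 * L + 3 ≤ 2 * n + (L + 6) * (p * q)
  above-g₁⇒lower-bound n above = begin
    (2 * p + K) * (p * q) + 2 * L + 3                 ≡⟨ solve (p ∷ K ∷ q ∷ L ∷ []) ⟩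
    ((2 * p + K) * (p * q) + L) + (L + 3)             ≡⟨ cong (_+ (L + 3)) twice-g₀+d₃ ⟨
    2 * A + 5 * (p * q) + (L + 3)                     ≡⟨ rearrange A (p * q) L ⟩
    2 * suc A + (5 * (p * q) + (1 + L))               ≤⟨ +-monoˡ-≤ _ (*-monoʳ-≤ 2 above) ⟩
    2 * (n + (1 + L) * d₃) + (5 * (p * q) + (1 + L))  ≡⟨ solve (n ∷ L ∷ d₃ ∷ p ∷ q ∷ []) ⟩
    2 * n + (1 + L) * (1 + 2 * d₃) + 5 * (p * q)      ≡⟨ cong (λ t → 2 * n + (1 + L) * t + 5 * (p * q)) pq≡ ⟨
    2 * n + (1 + L) * (p * q) + 5 * (p * q)           ≡⟨ solve (n ∷ L ∷ p ∷ q ∷ []) ⟩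
    2 * n + (L + 6) * (p * q)                         ∎
    where
    open ≤-Reasoning
    A : ℕ
    A = (p′ ∸ 1) * (p * q) + (p ∸ 1) * (p′ * q) + K * (p * q′)
    rearrange : ∀ a m l → 2 * a + 5 * m + (l + 3) ≡ 2 * suc a + (5 * m + (1 + l))
    rearrange = solve-∀

  short-expansion : ∀ n T y z w → AboveG₁ n → T * (p * q) ≡ 2 * n + (y * q + z * p + w) →
                    WeightBound (y * q + z * p + w) (y + z + w) → y + z + w ≤ suc T
  short-expansion n T y z w above T*pq≡ weight =
    length≤suc-quotient {n = n} {D = y * q + z * p + w} {E = (2 * p + K) * (p * q)}
                        weight (above-g₁⇒lower-bound n above) T*pq≡

  same-parity : ∀ n T y z w → T * (p * q) ≡ 2 * n + (y * q + z * p + w) →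
                T + 2 * (T * d₃) ≡ y + z + w + 2 * (n + y * q′ + z * p′)
  same-parity n T y z w T*pq≡ = begin
    T + 2 * (T * d₃)                                   ≡⟨ solve (T ∷ d₃ ∷ []) ⟩
    T * (1 + 2 * d₃)                                   ≡⟨ cong (T *_) pq≡ ⟨
    T * (p * q)                                        ≡⟨ T*pq≡ ⟩
    2 * n + (y * q + z * p + w)                        ≡⟨ cong₂ (λ s t → 2 * n + (y * s + z * t + w)) q≡ p≡ ⟩
    2 * n + (y * (1 + 2 * q′) + z * (1 + 2 * p′) + w)  ≡⟨ solve (n ∷ y ∷ z ∷ w ∷ p′ ∷ q′ ∷ []) ⟩
    y + z + w + 2 * (n + y * q′ + z * p′)              ∎
    where open ≡-Reasoning

  twice-combination : ∀ x y z w →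
    2 * (x * (p * q) + y * (p′ * q) + z * (p * q′) + w * d₃) + (y * q + z * p + w)
      ≡ (y + z + w + 2 * x) * (p * q)
  twice-combination x y z w = begin
    2 * (x * (p * q) + y * (p′ * q) + z * (p * q′) + w * d₃) + (y * q + z * p + w)
      ≡⟨ solve (x ∷ y ∷ z ∷ w ∷ p ∷ q ∷ p′ ∷ q′ ∷ d₃ ∷ []) ⟩
    2 * x * (p * q) + y * (2 * (p′ * q) + q) + z * (2 * (p * q′) + p) + w * (1 + 2 * d₃)
      ≡⟨ cong₂ (λ s t → 2 * x * (p * q) + y * s + z * t + w * (1 + 2 * d₃)) p′q-half pq′-half ⟩
    2 * x * (p * q) + y * (p * q) + z * (p * q) + w * (1 + 2 * d₃)
      ≡⟨ cong (λ t → 2 * x * (p * q) + y * (p * q) + z * (p * q) + w * t) pq≡ ⟨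
    2 * x * (p * q) + y * (p * q) + z * (p * q) + w * (p * q)
      ≡⟨ solve (x ∷ y ∷ z ∷ w ∷ p ∷ q ∷ []) ⟩
    (y + z + w + 2 * x) * (p * q) ∎
    where
    open ≡-Reasoning
    p′q-half : 2 * (p′ * q) + q ≡ p * q
    p′q-half = begin
      2 * (p′ * q) + q  ≡⟨ solve (p′ ∷ q ∷ []) ⟩
      (1 + 2 * p′) * q  ≡⟨ cong (_* q) p≡ ⟨
      p * q             ∎
    pq′-half : 2 * (p * q′) + p ≡ p * q
    pq′-half = begin
      2 * (p * q′) + p  ≡⟨ solve (p ∷ q′ ∷ []) ⟩
      p * (1 + 2 * q′)  ≡⟨ cong (p *_) q≡ ⟨
      p * q             ∎

  halve : ∀ n T x y z w → T * (p * q) ≡ 2 * n + (y * q + z * p + w) → T ≡ y + z + w + 2 * x →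
          n ≡ x * (p * q) + y * (p′ * q) + z * (p * q′) + w * d₃
  halve n T x y z w T*pq≡ T≡ = *-cancelˡ-≡ n _ 2 (+-cancelʳ-≡ (y * q + z * p + w) _ _ (begin
    2 * n + (y * q + z * p + w)    ≡⟨ T*pq≡ ⟨
    T * (p * q)                    ≡⟨ cong (_* (p * q)) T≡ ⟩
    (y + z + w + 2 * x) * (p * q)  ≡⟨ twice-combination x y z w ⟨
    2 * (x * (p * q) + y * (p′ * q) + z * (p * q′) + w * d₃) + (y * q + z * p + w) ∎))
    where open ≡-Reasoning

  representable-above : ∀ n → AboveG₁ n →
    ∃[ x ] ∃[ y ] ∃[ z ] ∃[ w ] n ≡ x * (p * q) + y * (p′ * q) + z * (p * q′) + w * d₃
  representable-above n above with divide-up (2 * n) (p * q)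
  ... | T , D , D<pq , T*pq≡ with bounded-expansion D<pq
  ... | y , z , w , refl , weight
    with x , T≡ ← even-gap {α = T * d₃} {β = n + y * q′ + z * p′}
                           (short-expansion n T y z w above T*pq≡ weight) (same-parity n T y z w T*pq≡)
    = x , y , z , w , halve n T x y z w T*pq≡ T≡

-- Addition of non-negative integers computes, so only the products need rewriting.
pos-combination₃ : ∀ x y z a b c →
  + (x * a + y * b + z * c) ≡ + x ℤ.* + a ℤ.+ + y ℤ.* + b ℤ.+ + z ℤ.* + c
pos-combination₃ x y z a b c =
  cong₂ ℤ._+_ (cong₂ ℤ._+_ (ℤₚ.pos-* x a) (ℤₚ.pos-* y b)) (ℤₚ.pos-* z c)

pos-combination₄ : ∀ x y z w a b c d →
  + (x * a + y * b + z * c + w * d) ≡ + x ℤ.* + a ℤ.+ + y ℤ.* + b ℤ.+ + z ℤ.* + c ℤ.+ + w ℤ.* + d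
pos-combination₄ x y z w a b c d = cong₂ ℤ._+_ (pos-combination₃ x y z a b c) (ℤₚ.pos-* w d)

shift-below : ∀ (s d l n : ℤ.ℤ) →
  s ℤ.+ ℤ.- + 1 ℤ.* d ℤ.- l ℤ.* d ℤ.< n → s ℤ.< n ℤ.+ (+ 1 ℤ.+ l) ℤ.* d
shift-below s d l n below =
  subst (ℤ._< n ℤ.+ (+ 1 ℤ.+ l) ℤ.* d) (cancel s d l) (ℤₚ.+-monoˡ-< ((+ 1 ℤ.+ l) ℤ.* d) below)
  where
  cancel : ∀ s d l → s ℤ.+ ℤ.- + 1 ℤ.* d ℤ.- l ℤ.* d ℤ.+ (+ 1 ℤ.+ l) ℤ.* d ≡ s
  cancel = ℤ-Solver.solve-∀

module ParamsFacts (p q : ℕ) .{{_ : NonZero p}} where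
  open Params p q

  p≡1+2p′ : Prime p → 2 < p → p ≡ 1 + 2 * p′
  p≡1+2p′ p-prime 2<p = odd⇒≡1+2*[n∸1]/2 (prime>2⇒odd p-prime 2<p)

  q≡1+2q′ : Prime q → 2 < q → q ≡ 1 + 2 * q′
  q≡1+2q′ q-prime 2<q = odd⇒≡1+2*[n∸1]/2 (prime>2⇒odd q-prime 2<q)

  pq≡1+2d₃ : p ≡ 1 + 2 * p′ → q ≡ 1 + 2 * q′ → p * q ≡ 1 + 2 * d₃
  pq≡1+2d₃ p≡ q≡ =
    odd⇒≡1+2*[n∸1]/2 (p′ + q′ + 2 * (p′ * q′) , trans (cong₂ _*_ p≡ q≡) (odd*odd p′ q′))

  q≡κp+λ : q ≡ κ * p + λ′
  q≡κp+λ = trans (m≡m%n+[m/n]*n q p) (+-comm λ′ (κ * p))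

  κ+2λ≤p : κ + λ′ ≤ p ∸ λ′ → κ + 2 * λ′ ≤ p
  κ+2λ≤p κ+λ≤p∸λ = begin
    κ + 2 * λ′     ≡⟨ cong (λ t → κ + (λ′ + t)) (+-identityʳ λ′) ⟩
    κ + (λ′ + λ′)  ≡⟨ +-assoc κ λ′ λ′ ⟨
    κ + λ′ + λ′    ≤⟨ +-monoˡ-≤ λ′ κ+λ≤p∸λ ⟩
    p ∸ λ′ + λ′    ≡⟨ m∸n+n≡m (<⇒≤ (m%n<n q p)) ⟩
    p              ∎
    where open ≤-Reasoning

  g₁<⇒AboveG₁ : ∀ n → g₁ ℤ.< + n → (p′ ∸ 1) * d₀ + (p ∸ 1) * d₁ + κ * d₂ < n + (1 + λ′) * d₃
  g₁<⇒AboveG₁ n g₁<n = ℤₚ.drop‿+<+ (subst₂ ℤ._<_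
    (sym (pos-combination₃ (p′ ∸ 1) (p ∸ 1) κ d₀ d₁ d₂))
    (cong (ℤ._+_ (+ n)) (sym (ℤₚ.pos-* (1 + λ′) d₃)))
    (shift-below (+ (p′ ∸ 1) ℤ.* + d₀ ℤ.+ + (p ∸ 1) ℤ.* + d₁ ℤ.+ + κ ℤ.* + d₂)
                 (+ d₃) (+ λ′) (+ n) g₁<n))

  ℕ-representation⇒Representable : ∀ {n} →
    ∃[ x ] ∃[ y ] ∃[ z ] ∃[ w ] n ≡ x * d₀ + y * d₁ + z * d₂ + w * d₃ → Representable n
  ℕ-representation⇒Representable (x , y , z , w , n≡) =
    x , y , z , w , trans (cong +_ n≡) (pos-combination₄ x y z w d₀ d₁ d₂ d₃)

corollary6p2 : (p q : ℕ) → Prime p → Prime q → 2 < p → p < q →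
    .{{_ : NonZero p}} →
    let open Params p q in
    κ + λ′ ≤ p ∸ λ′ →
    ((g : ℕ) → IsFrobeniusNumber g → (+ g) ℤ.≤ g₁)
      × ((n : ℕ) → g₁ ℤ.< + n → Representable n)
corollary6p2 p q p-prime q-prime 2<p p<q κ+λ≤p∸λ = frobenius≤g₁ , representable
  where
  open Params p q
  open ParamsFacts p q
  p≡ : p ≡ 1 + 2 * p′
  p≡ = p≡1+2p′ p-prime 2<p
  q≡ : q ≡ 1 + 2 * q′
  q≡ = q≡1+2q′ q-prime (<-trans 2<p p<q)
  representable : (n : ℕ) → g₁ ℤ.< + n → Representable n
  representable n g₁<n = ℕ-representation⇒Representable
    (representable-above {p} {q} {p′} {q′} {d₃} {κ} {λ′}
                         p≡ q≡ (pq≡1+2d₃ p≡ q≡) q≡κp+λ (1+2h>2⇒0<h p≡ 2<p) (m≥n⇒m/n>0 (<⇒≤ p<q))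
                         (κ+2λ≤p κ+λ≤p∸λ) n (g₁<⇒AboveG₁ n g₁<n))
  frobenius≤g₁ : (g : ℕ) → IsFrobeniusNumber g → (+ g) ℤ.≤ g₁
  frobenius≤g₁ g (_ , g-unrepresentable , _) =
    ℤₚ.≮⇒≥ (λ g₁<g → g-unrepresentable (representable g g₁<g))
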